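{- Let $G$ be a finite simple graph. If $G$ has a near-obstruction $(P,z)$, then there is a set of vertices $X\subseteq V(P)\cup\{z\}$ such that the induced subgraph $G[X]$ is a Meyniel obstruction.
   Context: A Meyniel obstruction is an odd cycle with at least five vertices and at most one chord. A chord of a path or cycle is an edge of the graph joining two non-consecutive vertices of it. A near-obstruction in $G$ is a pair $(P,z)$ where $P=v_0\text{ - }\cdots\text{ - }v_p$ is a path in $G$ with $p\ge3$ odd, $P$ has at most one chord and such a chord, if any, is $v_{t-1}v_{t+1}$ with $0<t<p-1$, $z$ is a vertex of $G$ not on $P$ adjacent to both $v_0$ and $v_p$, and one of the following holds: (Type 1) $v_0v_2$ is the only chord of $P$ and $z$ is adjacent to neither $v_1$ nor $v_2$; (Type 2) $v_1v_3$ is the only chord of $P$ and $z$ is non-adjacent to at least one of $v_1,v_3$; (Type 3) $v_0v_2$ is not a chord of $P$ and $z$ is not adjacent to $v_1$; (Type 4) neither $v_0v_2$ nor $v_1v_3$ is a chord of $P$, and $z$ is adjacent to $v_1$ and not to $v_2$. -}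

module Defs where

open import Data.Nat using (ℕ; zero; suc; _+_; _*_; _∸_; _≤_; _<_)
open import Data.Fin using (Fin)
open import Data.Product using (Σ; ∃; _×_; _,_)
open import Data.Sum using (_⊎_)
open import Relation.Nullary using (¬_; Dec)
open import Relation.Binary.PropositionalEquality using (_≡_; _≢_)

record Graph (n : ℕ) : Set₁ where
  field
    Adj    : Fin n → Fin n → Set
    sym    : ∀ {x y} → Adj x y → Adj y x
    irrefl : ∀ {x} → ¬ Adj x x
    dec    : ∀ x y → Dec (Adj x y)

Odd : ℕ → Set
Odd k = Σ ℕ λ m → k ≡ suc (2 * m)

module _ {n : ℕ} (G : Graph n) where
  open Graph G

  -- Paths  v 0 - v 1 - ... - v p   (only indices 0..p matter)
  IsPath : (v : ℕ → Fin n) (p : ℕ) → Set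
  IsPath v p =
    (∀ i j → i ≤ p → j ≤ p → v i ≡ v j → i ≡ j) ×
    (∀ i → i < p → Adj (v i) (v (suc i)))

  PathChord : (v : ℕ → Fin n) (p : ℕ) → ℕ → ℕ → Set
  PathChord v p i j = (suc (suc i) ≤ j) × (j ≤ p) × Adj (v i) (v j)

  AtMostOnePathChord : (v : ℕ → Fin n) (p : ℕ) → Set
  AtMostOnePathChord v p = ∀ i j i' j' →
    PathChord v p i j → PathChord v p i' j' → (i ≡ i') × (j ≡ j')

  OnPath : (v : ℕ → Fin n) (p : ℕ) → Fin n → Set
  OnPath v p x = Σ ℕ λ i → (i ≤ p) × (v i ≡ x)

  NearObstruction : (v : ℕ → Fin n) (p : ℕ) (z : Fin n) → Set
  NearObstruction v p z =
    (3 ≤ p) × Odd p × IsPath v p × AtMostOnePathChord v p ×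
    (∀ i j → PathChord v p i j → (j ≡ suc (suc i)) × (suc (suc (suc i)) ≤ p)) ×
    ¬ OnPath v p z × Adj z (v 0) × Adj z (v p) ×
    (
      (PathChord v p 0 2 × ¬ Adj z (v 1) × ¬ Adj z (v 2))
    ⊎
      (PathChord v p 1 3 × ¬ (Adj z (v 1) × Adj z (v 3)))
    ⊎
      (¬ PathChord v p 0 2 × ¬ Adj z (v 1))
    ⊎
      (¬ PathChord v p 0 2 × ¬ PathChord v p 1 3 × Adj z (v 1) × ¬ Adj z (v 2)))

  -- Cycles  c 0 - c 1 - ... - c (k-1) - c 0   (only indices < k matter)
  IsCycle : (c : ℕ → Fin n) (k : ℕ) → Set
  IsCycle c k =
    (3 ≤ k) ×
    (∀ i j → i < k → j < k → c i ≡ c j → i ≡ j) ×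
    (∀ i → suc i < k → Adj (c i) (c (suc i))) ×
    Adj (c (k ∸ 1)) (c 0)

  CycleChord : (c : ℕ → Fin n) (k : ℕ) → ℕ → ℕ → Set
  CycleChord c k i j =
    (suc i < j) × (j < k) × ¬ ((i ≡ 0) × (suc j ≡ k)) × Adj (c i) (c j)

  AtMostOneCycleChord : (c : ℕ → Fin n) (k : ℕ) → Set
  AtMostOneCycleChord c k = ∀ i j i' j' →
    CycleChord c k i j → CycleChord c k i' j' → (i ≡ i') × (j ≡ j')

  -- The induced subgraph G[X], X = { c i | i < k }, is a Meyniel
  -- obstruction: an odd cycle on ≥ 5 vertices (through all of X, in the
  -- order c 0, ..., c (k-1)) with at most one chord.
  InducedMeynielObstruction : (c : ℕ → Fin n) (k : ℕ) → Set
  InducedMeynielObstruction c k =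
    (5 ≤ k) × Odd k × IsCycle c k × AtMostOneCycleChord c k

{-# OPTIONS --safe #-}
module Submission where

-- Call i a neighbour position when z is adjacent to v i. On a chordless stretch of a path, two
-- consecutive neighbour positions a < b close the induced cycle z, v a, …, v b, so an odd gap b - a ≥ 3
-- is a Meyniel obstruction, and so is a gap of length 1 next to a gap of even length: together they
-- close an odd cycle whose only chord joins z to their common end. Failing both, the neighbour
-- positions of the stretch are all of it or all of one parity. For a chordless P the type of (P, z)
-- rules out the former and the oddness of p the latter. If P has its chord v s v (s+2), the same
-- argument on P with v (s+1) cut out leaves z only neighbours of even index before the chord and of
-- odd index after it. Then, if z ≁ v (s+1), the neighbours around s+1 form an odd gap whose cycle has
-- the path chord as its only chord; if z ~ v (s+1), the argument on the chordless part of P before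
-- v (s+1) (s even) or after it (s odd) can only end in an obstruction.

open import Defs
open import Data.Nat using (ℕ; zero; suc; _+_; _*_; _≤_; _<_; z≤n; s≤s; z<s; s<s; _≤?_; parity)
open import Data.Nat.Properties
open import Data.Nat.Induction using (<-wellFounded)
open import Data.Parity.Base using (0ℙ; 1ℙ; _⁻¹) renaming (_+_ to _+ℙ_)
import Data.Parity.Properties as ℙ
open import Data.Fin using (Fin)
open import Data.Product using (Σ; ∃; _×_; _,_; proj₁; proj₂)
open import Data.Sum using (_⊎_; inj₁; inj₂)
open import Function using (_∘_)
open import Induction.WellFounded using (Acc; acc)
open import Relation.Binary using (tri<; tri≈; tri>)
open import Relation.Nullary using (¬_; Dec; yes; no; contradiction)
open import Relation.Nullary.Decidable using (_×-dec_)
open import Relation.Binary.PropositionalEquality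

parity-suc : ∀ n {x} → parity n ≡ x → parity (suc n) ≡ x ⁻¹
parity-suc n refl = ℙ.+-homo-+ 1 n

parity-+-even : ∀ a {g} → parity g ≡ 0ℙ → parity (a + g) ≡ parity a
parity-+-even a {g} g-even =
  trans (ℙ.+-homo-+ a g) (trans (cong (parity a +ℙ_) g-even) (ℙ.+-identityʳ (parity a)))

parity-+-odd : ∀ a {g} → parity g ≡ 1ℙ → parity (a + g) ≡ parity a ⁻¹
parity-+-odd a {g} g-odd =
  trans (ℙ.+-homo-+ a g) (trans (cong (parity a +ℙ_) g-odd) (ℙ.+-comm (parity a) 1ℙ))

Odd⇒parity≡1ℙ : ∀ {k} → Odd k → parity k ≡ 1ℙ
Odd⇒parity≡1ℙ (m , refl) = parity-suc (2 * m) (ℙ.*-homo-* 2 m)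

parity≡1ℙ⇒Odd : ∀ k → parity k ≡ 1ℙ → Odd k
parity≡1ℙ⇒Odd zero ()
parity≡1ℙ⇒Odd (suc zero) _ = 0 , refl
parity≡1ℙ⇒Odd (suc (suc k)) k-odd with parity≡1ℙ⇒Odd k k-odd
... | m , refl = suc m , cong suc (sym (*-suc 2 m))

parity≡1ℙ⇒0< : ∀ {g} → parity g ≡ 1ℙ → 0 < g
parity≡1ℙ⇒0< {zero} ()
parity≡1ℙ⇒0< {suc g} _ = z<s

data GapView (a : ℕ) : ℕ → Set where
  unit : GapView a (suc a)
  odd  : ∀ {g} → 3 ≤ g → parity g ≡ 1ℙ → GapView a (a + g)
  even : ∀ {g} → 2 ≤ g → parity g ≡ 0ℙ → GapView a (a + g)

gapView : ∀ {a h} → a < h → GapView a h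
gapView {a} a<h with m≤n⇒∃[o]m+o≡n (<⇒≤ a<h)
... | zero , refl = contradiction a<h (<-irrefl (sym (+-identityʳ a)))
... | suc zero , refl = subst (GapView a) (+-comm 1 a) unit
... | suc (suc g) , refl with parity g in g-parity
...   | 0ℙ = even (s≤s (s≤s z≤n)) g-parity
...   | 1ℙ = odd (s≤s (s≤s (parity≡1ℙ⇒0< g-parity))) g-parity

sameParity⇒evenGap : ∀ {a h} → a < h → parity h ≡ parity a → ∃ λ g → 2 ≤ g × parity g ≡ 0ℙ × a + g ≡ h
sameParity⇒evenGap {a} a<h same with gapView a<h
... | unit = contradiction (trans (sym same) (parity-suc a refl)) (ℙ.p≢p⁻¹ (parity a))
... | odd _ g-odd = contradiction (trans (sym same) (parity-+-odd a g-odd)) (ℙ.p≢p⁻¹ (parity a))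
... | even 2≤g g-even = _ , 2≤g , g-even , refl

punchIn : ℕ → ℕ → ℕ
punchIn zero    j       = suc j
punchIn (suc i) zero    = zero
punchIn (suc i) (suc j) = suc (punchIn i j)

punchIn-< : ∀ {i j} → j < i → punchIn i j ≡ j
punchIn-< {suc i} {zero}  _         = refl
punchIn-< {suc i} {suc j} (s<s j<i) = cong suc (punchIn-< j<i)

punchIn-≥ : ∀ {i j} → i ≤ j → punchIn i j ≡ suc j
punchIn-≥ {zero}          _         = refl
punchIn-≥ {suc i} {suc j} (s≤s i≤j) = cong suc (punchIn-≥ i≤j)

punchIn-≤ : ∀ i j → punchIn i j ≤ suc j
punchIn-≤ zero    j       = ≤-refl
punchIn-≤ (suc i) zero    = z≤n
punchIn-≤ (suc i) (suc j) = s≤s (punchIn-≤ i j)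

punchIn-injective : ∀ i {j k} → punchIn i j ≡ punchIn i k → j ≡ k
punchIn-injective zero    eq = suc-injective eq
punchIn-injective (suc i) {zero}  {zero}  _  = refl
punchIn-injective (suc i) {zero}  {suc k} ()
punchIn-injective (suc i) {suc j} {zero}  ()
punchIn-injective (suc i) {suc j} {suc k} eq = cong suc (punchIn-injective i (suc-injective eq))

punchIn-mono-< : ∀ i {j k} → j < k → punchIn i j < punchIn i k
punchIn-mono-< zero    j<k = s<s j<k
punchIn-mono-< (suc i) {zero}  {suc k} _         = z<s
punchIn-mono-< (suc i) {suc j} {suc k} (s<s j<k) = s<s (punchIn-mono-< i j<k)

punchIn-gap : ∀ i {j k} → suc (suc j) ≤ k → suc (suc (punchIn i j)) ≤ punchIn i k
punchIn-gap i {j} 2+j≤k = ≤-trans (s≤s (punchIn-mono-< i (n<1+n j))) (punchIn-mono-< i 2+j≤k)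

punchIn-surjective : ∀ {q i k} → i ≤ q → k ≤ suc q → k ≢ i → ∃ λ j → j ≤ q × punchIn i j ≡ k
punchIn-surjective {q} {i} {k} i≤q k≤1+q k≢i with <-cmp k i
... | tri< k<i _ _ = k , ≤-trans (<⇒≤ k<i) i≤q , punchIn-< k<i
... | tri≈ _ k≡i _ = contradiction k≡i k≢i
... | tri> _ _ i<k = above i<k k≤1+q
  where
  above : ∀ {k} → i < k → k ≤ suc q → ∃ λ j → j ≤ q × punchIn i j ≡ k
  above {suc j} (s≤s i≤j) (s≤s j≤q) = j , j≤q , punchIn-≥ i≤j

module Gaps {S : ℕ → Set} (S? : ∀ i → Dec (S i)) where

  NoneBetween : ℕ → ℕ → Set
  NoneBetween a b = ∀ i → a < i → i < b → ¬ S i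

  AtMostOneBetween : ℕ → ℕ → Set
  AtMostOneBetween a b = Σ ℕ λ m → ∀ i → a < i → i < b → S i → i ≡ m

  AllIn : ℕ → ℕ → Set
  AllIn l h = ∀ i → l ≤ i → i ≤ h → S i

  ParityConstantOn : ℕ → ℕ → Set
  ParityConstantOn l h = ∀ i → l ≤ i → i ≤ h → S i → parity i ≡ parity l

  record OddWindow (l h : ℕ) : Set where
    constructor window
    field
      start length    : ℕ
      l≤start         : l ≤ start
      end≤h           : start + length ≤ h
      3≤length        : 3 ≤ length
      length-odd      : parity length ≡ 1ℙ
      start∈S         : S start
      end∈S           : S (start + length)
      atMostOneInside : AtMostOneBetween start (start + length)

  data GapOutcome (l h : ℕ) : Set where
    oddWindow      : OddWindow l h → GapOutcome l h
    allIn          : AllIn l h → GapOutcome l h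
    parityConstant : ParityConstantOn l h → GapOutcome l h

  noneBetween-suc : ∀ a → NoneBetween a (suc a)
  noneBetween-suc a i a<i i<1+a _ = <⇒≱ a<i (≤-pred i<1+a)

  noneBetween-extend : ∀ {a h} → NoneBetween a h → ¬ S h → NoneBetween a (suc h)
  noneBetween-extend none ¬Sh i a<i i<1+h with m<1+n⇒m<n∨m≡n i<1+h
  ... | inj₁ i<h  = none i a<i i<h
  ... | inj₂ refl = ¬Sh

  onlyBetween : ∀ {a b c} → NoneBetween a b → NoneBetween b c → AtMostOneBetween a c
  onlyBetween {a} {b} {c} none₁ none₂ = b , only
    where
    only : ∀ i → a < i → i < c → S i → i ≡ b
    only i a<i i<c Si with <-cmp i b
    ... | tri< i<b _ _ = contradiction Si (none₁ i a<i i<b)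
    ... | tri≈ _ i≡b _ = i≡b
    ... | tri> _ _ b<i = contradiction Si (none₂ i b<i i<c)

  beforeOrEnd : ∀ {a h i} → NoneBetween a h → i ≤ h → S i → i ≤ a ⊎ i ≡ h
  beforeOrEnd {a} {i = i} none i≤h Si with i ≤? a
  ... | yes i≤a = inj₁ i≤a
  ... | no i≰a with m≤n⇒m<n∨m≡n i≤h
  ...   | inj₁ i<h = contradiction Si (none i (≰⇒> i≰a) i<h)
  ...   | inj₂ i≡h = inj₂ i≡h

  previous : ∀ {l h} → S l → l < h → Σ ℕ λ a → l ≤ a × a < h × S a × NoneBetween a h
  previous {h = suc h} Sl (s≤s l≤h) with S? h
  ... | yes Sh = h , l≤h , ≤-refl , Sh , noneBetween-suc h
  ... | no ¬Sh with m≤n⇒m<n∨m≡n l≤h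
  ...   | inj₂ refl = contradiction Sl ¬Sh
  ...   | inj₁ l<h with previous Sl l<h
  ...     | a , l≤a , a<h , Sa , none = a , l≤a , m<n⇒m<1+n a<h , Sa , noneBetween-extend none ¬Sh

  StraddlingGap : ℕ → ℕ → Set
  StraddlingGap i h = Σ ℕ λ a → Σ ℕ λ b → a < i × i < b × b ≤ h × S a × S b × NoneBetween a b

  straddlingGap-weaken : ∀ {i a h} → StraddlingGap i a → a ≤ h → StraddlingGap i h
  straddlingGap-weaken (a , b , a<i , i<b , b≤a , Sa , Sb , none) a≤h =
    a , b , a<i , i<b , ≤-trans b≤a a≤h , Sa , Sb , none

  straddlingGap : ∀ {l i h} → S l → S h → l ≤ i → i ≤ h → ¬ S i → StraddlingGap i h
  straddlingGap {l} {i} Sl Sh l≤i i≤h ¬Si = go (<-wellFounded _) Sh i≤h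
    where
    i<member : ∀ {h} → S h → i ≤ h → i < h
    i<member Sh i≤h = ≤∧≢⇒< i≤h λ { refl → ¬Si Sh }

    go : ∀ {h} → Acc _<_ h → S h → i ≤ h → StraddlingGap i h
    go {h} (acc below) Sh i≤h with previous Sl (≤-<-trans l≤i (i<member Sh i≤h))
    ... | a , _ , a<h , Sa , none with <-cmp a i
    ...   | tri< a<i _ _ = a , h , a<i , i<member Sh i≤h , ≤-refl , Sa , Sh , none
    ...   | tri≈ _ refl _ = contradiction Sa ¬Si
    ...   | tri> _ _ i<a = straddlingGap-weaken (go (below a<h) Sa (<⇒≤ i<a)) (<⇒≤ a<h)

  allIn-refl : ∀ {l} → S l → AllIn l l
  allIn-refl Sl i l≤i i≤l = subst S (≤-antisym l≤i i≤l) Sl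

  allIn-suc : ∀ {l a} → AllIn l a → S (suc a) → AllIn l (suc a)
  allIn-suc all Sa+1 i l≤i i≤1+a with m≤n⇒m<n∨m≡n i≤1+a
  ... | inj₁ i<1+a = all i l≤i (≤-pred i<1+a)
  ... | inj₂ refl  = Sa+1

  parityConstant-refl : ∀ {l} → ParityConstantOn l l
  parityConstant-refl i l≤i i≤l _ = cong parity (≤-antisym i≤l l≤i)

  evenGapParity : ∀ {l a g} → l ≤ a → S a → NoneBetween a (a + g) → parity g ≡ 0ℙ →
                  ParityConstantOn l a → ParityConstantOn l (a + g)
  evenGapParity {a = a} l≤a Sa none g-even pc i l≤i i≤h Si with beforeOrEnd none i≤h Si
  ... | inj₁ i≤a = pc i l≤i i≤a Si
  ... | inj₂ refl = trans (parity-+-even a g-even) (pc a l≤a ≤-refl Sa)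

  widen : ∀ {l a h} → OddWindow l a → a ≤ h → OddWindow l h
  widen (window s d l≤s s+d≤a 3≤d d-odd Ss Ss+d atMostOne) a≤h =
    window s d l≤s (≤-trans s+d≤a a≤h) 3≤d d-odd Ss Ss+d atMostOne

  oddGapWindow : ∀ {l a g} → l ≤ a → S a → S (a + g) → NoneBetween a (a + g) →
                 3 ≤ g → parity g ≡ 1ℙ → OddWindow l (a + g)
  oddGapWindow {a = a} l≤a Sa Sh none 3≤g g-odd =
    window a _ l≤a ≤-refl 3≤g g-odd Sa Sh (a , λ i a<i i<h Si → contradiction Si (none i a<i i<h))

  -- In both lemmas below the window is the union of two consecutive gaps, one of length 1
  -- and one of even length, so its only inner member is their common end.
  runThenEvenGap : ∀ {l a g} → l < a → AllIn l a → S (a + g) → NoneBetween a (a + g) →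
                   2 ≤ g → parity g ≡ 0ℙ → OddWindow l (a + g)
  runThenEvenGap {a = suc a} {g} (s≤s l≤a) all Sh none 2≤g g-even =
    window a (suc g) l≤a (≤-reflexive (+-suc a g)) (s≤s 2≤g) (parity-suc g g-even)
           (all a l≤a (n≤1+n a)) (subst S (sym (+-suc a g)) Sh)
           (onlyBetween (noneBetween-suc a) λ i a<i i<h → none i a<i (subst (i <_) (+-suc a g) i<h))

  evenGapThenUnit : ∀ {l a} → S l → l < a → S a → S (suc a) → ParityConstantOn l a → OddWindow l (suc a)
  evenGapThenUnit Sl l<a Sa Sa+1 pc with previous Sl l<a
  ... | a′ , l≤a′ , a′<a , Sa′ , none
      with sameParity⇒evenGap a′<a (trans (pc _ (<⇒≤ l<a) ≤-refl Sa) (sym (pc a′ l≤a′ (<⇒≤ a′<a) Sa′)))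
  ...   | g , 2≤g , g-even , refl =
    window a′ (suc g) l≤a′ (≤-reflexive (+-suc a′ g)) (s≤s 2≤g) (parity-suc g g-even)
           Sa′ (subst S (sym (+-suc a′ g)) Sa+1)
           (onlyBetween none λ i a<i i<h → noneBetween-suc (a′ + g) i a<i (subst (i <_) (+-suc a′ g) i<h))

  extend : ∀ {l a h} → S l → l ≤ a → a < h → S a → S h → NoneBetween a h → GapOutcome l a → GapOutcome l h
  extend _ _ a<h _ _ _ (oddWindow W) = oddWindow (widen W (<⇒≤ a<h))
  extend Sl l≤a a<h Sa Sh none (allIn all) with gapView a<h
  ... | unit = allIn (allIn-suc all Sh)
  ... | odd 3≤g g-odd = oddWindow (oddGapWindow l≤a Sa Sh none 3≤g g-odd)
  ... | even 2≤g g-even with m≤n⇒m<n∨m≡n l≤a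
  ...   | inj₁ l<a = oddWindow (runThenEvenGap l<a all Sh none 2≤g g-even)
  ...   | inj₂ refl = parityConstant (evenGapParity ≤-refl Sa none g-even parityConstant-refl)
  extend Sl l≤a a<h Sa Sh none (parityConstant pc) with gapView a<h
  ... | odd 3≤g g-odd = oddWindow (oddGapWindow l≤a Sa Sh none 3≤g g-odd)
  ... | even 2≤g g-even = parityConstant (evenGapParity l≤a Sa none g-even pc)
  ... | unit with m≤n⇒m<n∨m≡n l≤a
  ...   | inj₁ l<a = oddWindow (evenGapThenUnit Sl l<a Sa Sh pc)
  ...   | inj₂ refl = allIn (allIn-suc (allIn-refl Sa) Sh)

  gapOutcome : ∀ {l h} → S l → S h → l ≤ h → GapOutcome l h
  gapOutcome {l} Sl Sh l≤h = go (<-wellFounded _) Sh l≤h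
    where
    go : ∀ {h} → Acc _<_ h → S h → l ≤ h → GapOutcome l h
    go (acc below) Sh l≤h with m≤n⇒m<n∨m≡n l≤h
    ... | inj₂ refl = allIn (allIn-refl Sh)
    ... | inj₁ l<h with previous Sl l<h
    ...   | a , l≤a , a<h , Sa , none = extend Sl l≤a a<h Sa Sh none (go (below a<h) Sa l≤a)

module _ {n : ℕ} (G : Graph n) where
  open Graph G using (Adj; dec) renaming (sym to adj-sym)

  InducedMeynielObstructionIn : (Fin n → Set) → Set
  InducedMeynielObstructionIn X =
    Σ ℕ λ k → Σ (ℕ → Fin n) λ c → InducedMeynielObstruction G c k × (∀ i → i < k → X (c i))

  NoChordWithin : (ℕ → Fin n) → ℕ → ℕ → ℕ → Set
  NoChordWithin w q l h = ∀ i j → l ≤ i → j ≤ h → ¬ PathChord G w q i j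

  windowCycle : Fin n → (ℕ → Fin n) → ℕ → ℕ → Fin n
  windowCycle z w a zero    = z
  windowCycle z w a (suc i) = w (a + i)

  shortcut-isPath : ∀ {v q s} → IsPath G v (suc q) → PathChord G v (suc q) s (suc (suc s)) →
                    IsPath G (v ∘ punchIn (suc s)) q
  shortcut-isPath {v} {q} {s} (injective , steps) chord = injective′ , steps′
    where
    injective′ : ∀ i j → i ≤ q → j ≤ q → v (punchIn (suc s) i) ≡ v (punchIn (suc s) j) → i ≡ j
    injective′ i j i≤q j≤q eq = punchIn-injective (suc s)
      (injective _ _ (≤-trans (punchIn-≤ (suc s) i) (s≤s i≤q)) (≤-trans (punchIn-≤ (suc s) j) (s≤s j≤q)) eq)

    steps′ : ∀ i → i < q → Adj (v (punchIn (suc s) i)) (v (punchIn (suc s) (suc i)))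
    steps′ i i<q with <-cmp i s
    ... | tri< i<s _ _ rewrite punchIn-< (m<n⇒m<1+n i<s) | punchIn-< (s<s i<s) = steps i (m<n⇒m<1+n i<q)
    ... | tri≈ _ refl _ rewrite punchIn-< (n<1+n i) | punchIn-≥ (≤-refl {suc i}) = proj₂ (proj₂ chord)
    ... | tri> _ _ s<i rewrite punchIn-≥ s<i | punchIn-≥ (m≤n⇒m≤1+n s<i) = steps (suc i) (s<s i<q)

  shortcut-chordless : ∀ {v q s} → AtMostOnePathChord G v (suc q) →
                       PathChord G v (suc q) s (suc (suc s)) →
                       ∀ i j → ¬ PathChord G (v ∘ punchIn (suc s)) q i j
  shortcut-chordless {s = s} unique chord i j (2+i≤j , j≤q , adj)
    with unique _ _ _ _ (punchIn-gap (suc s) 2+i≤j , ≤-trans (punchIn-≤ (suc s) j) (s≤s j≤q) , adj) chord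
  ... | i↦s , j↦2+s = 1+n≰n (subst₂ (λ x y → suc (suc x) ≤ y) i≡s j≡1+s 2+i≤j)
    where
    i≡s : i ≡ s
    i≡s = punchIn-injective (suc s) (trans i↦s (sym (punchIn-< (n<1+n s))))
    j≡1+s : j ≡ suc s
    j≡1+s = punchIn-injective (suc s) (trans j↦2+s (sym (punchIn-≥ ≤-refl)))

  module Window {z : Fin n} {w : ℕ → Fin n} {q : ℕ}
                (path : IsPath G w q) (z∉w : ∀ i → i ≤ q → w i ≢ z)
                {X : Fin n → Set} (Xz : X z) (Xw : ∀ i → i ≤ q → X (w i)) where
    open Gaps (λ i → dec z (w i)) public

    data WindowChord (a d : ℕ) : ℕ → ℕ → Set where
      spoke : ∀ {k} → a < a + k → a + k < a + d → Adj z (w (a + k)) → WindowChord a d 0 (suc k)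
      rim   : ∀ {i j} → a + j ≤ a + d → PathChord G w q (a + i) (a + j) → WindowChord a d (suc i) (suc j)

    windowChord : ∀ {a d i j} → a + d ≤ q → CycleChord G (windowCycle z w a) (suc (suc d)) i j →
                  WindowChord a d i j
    windowChord {i = zero}  {zero}  _ (() , _)
    windowChord {i = suc i} {zero}  _ (() , _)
    windowChord {a} {d} {zero} {suc j} _ (2≤1+j , 1+j<2+d , notClosing , adj) =
      spoke (m<m+n a (≤-pred 2≤1+j)) (+-monoʳ-< a j<d) adj
      where
      j<d : j < d
      j<d = ≤∧≢⇒< (≤-pred (≤-pred 1+j<2+d)) λ j≡d → notClosing (refl , cong (suc ∘ suc) j≡d)
    windowChord {a} {d} {suc i} {suc j} a+d≤q (3+i≤1+j , 1+j<2+d , _ , adj) =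
      rim a+j≤a+d (gap , ≤-trans a+j≤a+d a+d≤q , adj)
      where
      a+j≤a+d : a + j ≤ a + d
      a+j≤a+d = +-monoʳ-≤ a (≤-pred (≤-pred 1+j<2+d))
      gap : suc (suc (a + i)) ≤ a + j
      gap = subst (_≤ a + j) (trans (+-suc a (suc i)) (cong suc (+-suc a i))) (+-monoʳ-≤ a (≤-pred 3+i≤1+j))

    WindowCondition : ℕ → ℕ → Set
    WindowCondition a b =
      (NoneBetween a b × AtMostOnePathChord G w q) ⊎ (AtMostOneBetween a b × NoChordWithin w q a b)

    windowChord-unique : ∀ {a d i j i′ j′} → WindowCondition a (a + d) →
                         WindowChord a d i j → WindowChord a d i′ j′ → i ≡ i′ × j ≡ j′
    windowChord-unique (inj₁ (none , _)) (spoke a<k k<d z~k) _ = contradiction z~k (none _ a<k k<d)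
    windowChord-unique (inj₁ (none , _)) (rim _ _) (spoke a<k k<d z~k) = contradiction z~k (none _ a<k k<d)
    windowChord-unique {a} (inj₁ (_ , unique)) (rim _ c) (rim _ c′) =
      let i≡i′ , j≡j′ = unique _ _ _ _ c c′
      in cong suc (+-cancelˡ-≡ a _ _ i≡i′) , cong suc (+-cancelˡ-≡ a _ _ j≡j′)
    windowChord-unique (inj₂ (_ , noChord)) (rim j≤d c) _ = contradiction c (noChord _ _ (m≤m+n _ _) j≤d)
    windowChord-unique (inj₂ (_ , noChord)) (spoke _ _ _) (rim j≤d c) =
      contradiction c (noChord _ _ (m≤m+n _ _) j≤d)
    windowChord-unique {a} (inj₂ ((_ , only) , _)) (spoke a<k k<d z~k) (spoke a<k′ k′<d z~k′) =
      refl , cong suc (+-cancelˡ-≡ a _ _ (trans (only _ a<k k<d z~k) (sym (only _ a<k′ k′<d z~k′))))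

    windowIndex≤q : ∀ {a d i} → a + d ≤ q → suc i < suc (suc d) → a + i ≤ q
    windowIndex≤q {a} a+d≤q i<1+d = ≤-trans (+-monoʳ-≤ a (≤-pred (≤-pred i<1+d))) a+d≤q

    windowCycle-isCycle : ∀ {a d} → a + d ≤ q → 1 ≤ d → Adj z (w a) → Adj z (w (a + d)) →
                          IsCycle G (windowCycle z w a) (suc (suc d))
    windowCycle-isCycle {a} {d} a+d≤q 1≤d z~wa z~wb = s≤s (s≤s 1≤d) , injective , steps , adj-sym z~wb
      where
      injective : ∀ i j → i < suc (suc d) → j < suc (suc d) →
                  windowCycle z w a i ≡ windowCycle z w a j → i ≡ j
      injective zero    zero    _  _  _  = refl
      injective zero    (suc j) _  j< eq = contradiction (sym eq) (z∉w _ (windowIndex≤q a+d≤q j<))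
      injective (suc i) zero    i< _  eq = contradiction eq (z∉w _ (windowIndex≤q a+d≤q i<))
      injective (suc i) (suc j) i< j< eq =
        cong suc (+-cancelˡ-≡ a _ _ (proj₁ path _ _ (windowIndex≤q a+d≤q i<) (windowIndex≤q a+d≤q j<) eq))

      steps : ∀ i → suc i < suc (suc d) → Adj (windowCycle z w a i) (windowCycle z w a (suc i))
      steps zero    _  = subst (λ k → Adj z (w k)) (sym (+-identityʳ a)) z~wa
      steps (suc i) i< = subst (λ k → Adj (w (a + i)) (w k)) (sym (+-suc a i))
                               (proj₂ path (a + i) (subst (_≤ q) (+-suc a i) (windowIndex≤q a+d≤q i<)))

    windowObstruction : ∀ {a d} → a + d ≤ q → 3 ≤ d → parity d ≡ 1ℙ → Adj z (w a) → Adj z (w (a + d)) →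
                        WindowCondition a (a + d) → InducedMeynielObstructionIn X
    windowObstruction {a} {d} a+d≤q 3≤d d-odd z~wa z~wb condition =
      suc (suc d) , windowCycle z w a ,
      (s≤s (s≤s 3≤d) , parity≡1ℙ⇒Odd _ d-odd ,
       windowCycle-isCycle a+d≤q (≤-trans (s≤s z≤n) 3≤d) z~wa z~wb ,
       λ i j i′ j′ c c′ → windowChord-unique condition (windowChord a+d≤q c) (windowChord a+d≤q c′)) ,
      inX
      where
      inX : ∀ i → i < suc (suc d) → X (windowCycle z w a i)
      inX zero    _  = Xz
      inX (suc i) i< = Xw (a + i) (windowIndex≤q a+d≤q i<)

    chordlessInterval : ∀ {l h} → Adj z (w l) → Adj z (w h) → l ≤ h → h ≤ q → NoChordWithin w q l h →
                        InducedMeynielObstructionIn X ⊎ AllIn l h ⊎ ParityConstantOn l h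
    chordlessInterval z~wl z~wh l≤h h≤q noChord with gapOutcome z~wl z~wh l≤h
    ... | oddWindow (window a d l≤a a+d≤h 3≤d d-odd z~wa z~wb atMostOne) =
      inj₁ (windowObstruction (≤-trans a+d≤h h≤q) 3≤d d-odd z~wa z~wb
              (inj₂ (atMostOne , λ i j a≤i j≤b → noChord i j (≤-trans l≤a a≤i) (≤-trans j≤b a+d≤h))))
    ... | allIn all = inj₂ (inj₁ all)
    ... | parityConstant pc = inj₂ (inj₂ pc)

NearObstructionType : ∀ {n} → Graph n → (ℕ → Fin n) → ℕ → Fin n → Set
NearObstructionType G v p z =
    (PathChord G v p 0 2 × ¬ Adj z (v 1) × ¬ Adj z (v 2))
  ⊎ (PathChord G v p 1 3 × ¬ (Adj z (v 1) × Adj z (v 3)))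
  ⊎ (¬ PathChord G v p 0 2 × ¬ Adj z (v 1))
  ⊎ (¬ PathChord G v p 0 2 × ¬ PathChord G v p 1 3 × Adj z (v 1) × ¬ Adj z (v 2))
  where open Graph G using (Adj)

module NearObstructionProof {n : ℕ} {G : Graph n} {v : ℕ → Fin n} {q : ℕ} {z : Fin n}
  (3≤p : 3 ≤ suc q) (p-odd : Odd (suc q)) (path : IsPath G v (suc q))
  (unique : AtMostOnePathChord G v (suc q))
  (shortChords : ∀ i j → PathChord G v (suc q) i j → (j ≡ suc (suc i)) × (suc (suc (suc i)) ≤ suc q))
  (z∉P : ¬ OnPath G v (suc q) z) (z~v₀ : Graph.Adj G z (v 0)) (z~vₚ : Graph.Adj G z (v (suc q)))
  (type : NearObstructionType G v (suc q) z)
  where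
  open Graph G using (Adj; dec)

  X : Fin n → Set
  X y = OnPath G v (suc q) y ⊎ y ≡ z

  module OnP = Window G path (λ i i≤p vᵢ≡z → z∉P (i , i≤p , vᵢ≡z))
                         {X = X} (inj₂ refl) (λ i i≤p → inj₁ (i , i≤p , refl))

  ShortChordAt : ℕ → Set
  ShortChordAt s = PathChord G v (suc q) s (suc (suc s))

  OffChordNonNeighbour : Set
  OffChordNonNeighbour = Σ ℕ λ j → j ≤ suc q × ¬ Adj z (v j) × (∀ s → ShortChordAt s → j ≢ suc s)

  offChordNonNeighbour : OffChordNonNeighbour
  offChordNonNeighbour = fromType type
    where
    fromType : NearObstructionType G v (suc q) z → OffChordNonNeighbour
    fromType (inj₁ (c02 , _ , ¬z~v₂)) =
      2 , proj₁ (proj₂ c02) , ¬z~v₂ , λ { _ c refl → contradiction (proj₁ (unique _ _ _ _ c c02)) λ () }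
    fromType (inj₂ (inj₁ (c13 , ¬both))) with dec z (v 1)
    ... | yes z~v₁ = 3 , proj₁ (proj₂ c13) , (λ z~v₃ → ¬both (z~v₁ , z~v₃)) ,
                     λ { _ c refl → contradiction (proj₁ (unique _ _ _ _ c c13)) λ () }
    ... | no ¬z~v₁ = 1 , s≤s z≤n , ¬z~v₁ , λ { _ c refl → contradiction (proj₁ (unique _ _ _ _ c c13)) λ () }
    fromType (inj₂ (inj₂ (inj₁ (¬c02 , ¬z~v₁)))) = 1 , s≤s z≤n , ¬z~v₁ , λ { _ c refl → ¬c02 c }
    fromType (inj₂ (inj₂ (inj₂ (_ , ¬c13 , _ , ¬z~v₂)))) =
      2 , ≤-trans (n≤1+n 2) 3≤p , ¬z~v₂ , λ { _ c refl → ¬c13 c }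

  shortChordMiddle⇒0< : ∀ s → ShortChordAt s → Adj z (v (suc s)) → 0 < s
  shortChordMiddle⇒0< (suc s) _ _ = z<s
  shortChordMiddle⇒0< zero c02 z~v₁ = fromType type
    where
    fromType : NearObstructionType G v (suc q) z → 0 < 0
    fromType (inj₁ (_ , ¬z~v₁ , _))          = contradiction z~v₁ ¬z~v₁
    fromType (inj₂ (inj₁ (c13 , _)))         = contradiction (proj₁ (unique _ _ _ _ c02 c13)) λ ()
    fromType (inj₂ (inj₂ (inj₁ (¬c02 , _)))) = contradiction c02 ¬c02
    fromType (inj₂ (inj₂ (inj₂ (¬c02 , _)))) = contradiction c02 ¬c02

  shortChordAt? : ∀ s → Dec (ShortChordAt s)
  shortChordAt? s = (_ ≤? _) ×-dec (_ ≤? _) ×-dec dec (v s) (v (suc (suc s)))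

  notAllAdjacent : ¬ OnP.AllIn 0 (suc q)
  notAllAdjacent allAdjacent =
    let j , j≤p , ¬z~vⱼ , _ = offChordNonNeighbour in contradiction (allAdjacent j z≤n j≤p) ¬z~vⱼ

  noShortChord⇒chordless : ¬ (∃ λ s → s < suc q × ShortChordAt s) → ∀ i j → ¬ PathChord G v (suc q) i j
  noShortChord⇒chordless noShortChord i j c with shortChords i j c
  ... | refl , 3+i≤p = noShortChord (i , ≤-trans (m≤n+m (suc i) 2) 3+i≤p , c)

  chordlessCase : (∀ i j → ¬ PathChord G v (suc q) i j) → InducedMeynielObstructionIn G X
  chordlessCase noChord with OnP.chordlessInterval z~v₀ z~vₚ z≤n ≤-refl (λ i j _ _ → noChord i j)
  ... | inj₁ obstruction = obstruction
  ... | inj₂ (inj₁ allAdjacent) = contradiction allAdjacent notAllAdjacent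
  ... | inj₂ (inj₂ evenNeighbours) =
    contradiction (trans (sym (Odd⇒parity≡1ℙ p-odd)) (evenNeighbours _ z≤n ≤-refl z~vₚ)) λ ()

  module ShortChordCase (s : ℕ) (chord : ShortChordAt s) where
    w : ℕ → Fin n
    w = v ∘ punchIn (suc s)

    3+s≤p : suc (suc (suc s)) ≤ suc q
    3+s≤p = proj₂ (shortChords _ _ chord)

    1+s≤q : suc s ≤ q
    1+s≤q = ≤-trans (n≤1+n (suc s)) (≤-pred 3+s≤p)

    1+s≤p : suc s ≤ suc q
    1+s≤p = m≤n⇒m≤1+n 1+s≤q

    noChordBeforeMiddle : NoChordWithin G v (suc q) 0 (suc s)
    noChordBeforeMiddle i j _ j≤1+s c = 1+n≰n (subst (_≤ suc s) (proj₂ (unique _ _ _ _ c chord)) j≤1+s)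

    noChordAfterMiddle : NoChordWithin G v (suc q) (suc s) (suc q)
    noChordAfterMiddle i j 1+s≤i _ c = 1+n≰n (subst (suc s ≤_) (proj₁ (unique _ _ _ _ c chord)) 1+s≤i)

    onP : ∀ {i} → i ≤ q → punchIn (suc s) i ≤ suc q
    onP {i} i≤q = ≤-trans (punchIn-≤ (suc s) i) (s≤s i≤q)

    module OnW = Window G (shortcut-isPath G path chord) (λ i i≤q wᵢ≡z → z∉P (_ , onP i≤q , wᵢ≡z))
                        {X = X} (inj₂ refl) (λ i i≤q → inj₁ (_ , onP i≤q , refl))

    z~w_q : Adj z (w q)
    z~w_q = subst (λ k → Adj z (v k)) (sym (punchIn-≥ 1+s≤q)) z~vₚ

    notAllAdjacentOnW : ¬ OnW.AllIn 0 q
    notAllAdjacentOnW allAdjacent =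
      let j , j≤p , ¬z~vⱼ , offChords = offChordNonNeighbour
          i , i≤q , wᵢ≡vⱼ = punchIn-surjective 1+s≤q j≤p (offChords s chord)
      in ¬z~vⱼ (subst (λ k → Adj z (v k)) wᵢ≡vⱼ (allAdjacent i z≤n i≤q))

    module AlternatingNeighbours (evenOnW : OnW.ParityConstantOn 0 q) where
      evenBefore : ∀ {k} → k ≤ s → Adj z (v k) → parity k ≡ 0ℙ
      evenBefore {k} k≤s z~vₖ =
        evenOnW k z≤n (≤-trans k≤s (<⇒≤ 1+s≤q))
                (subst (λ t → Adj z (v t)) (sym (punchIn-< (s≤s k≤s))) z~vₖ)

      oddAfter : ∀ {k} → suc (suc s) ≤ k → k ≤ suc q → Adj z (v k) → parity k ≡ 1ℙ
      oddAfter {suc k} (s≤s 1+s≤k) (s≤s k≤q) z~vₖ =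
        parity-suc k (evenOnW k z≤n k≤q (subst (λ t → Adj z (v t)) (sym (punchIn-≥ 1+s≤k)) z~vₖ))

      middleNonNeighbour : ¬ Adj z (v (suc s)) → InducedMeynielObstructionIn G X
      middleNonNeighbour ¬z~mid with OnP.straddlingGap z~v₀ z~vₚ z≤n 1+s≤p ¬z~mid
      ... | a , b , a<1+s , 1+s<b , b≤p , z~vₐ , z~v_b , none with gapView (<-trans a<1+s 1+s<b)
      ...   | unit = contradiction (≤-pred a<1+s) (<⇒≱ (≤-pred 1+s<b))
      ...   | odd 3≤d d-odd = OnP.windowObstruction b≤p 3≤d d-odd z~vₐ z~v_b (inj₁ (none , unique))
      ...   | even _ d-even =
        contradiction (trans (sym (oddAfter 1+s<b b≤p z~v_b))
                             (trans (parity-+-even a d-even) (evenBefore (≤-pred a<1+s) z~vₐ))) λ ()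

      middleNeighbourEven : Adj z (v (suc s)) → parity s ≡ 0ℙ → InducedMeynielObstructionIn G X
      middleNeighbourEven z~mid s-even
        with OnP.chordlessInterval z~v₀ z~mid z≤n 1+s≤p noChordBeforeMiddle
      ... | inj₁ obstruction = obstruction
      ... | inj₂ (inj₁ allAdjacent) =
        contradiction (evenBefore (shortChordMiddle⇒0< s chord z~mid) (allAdjacent 1 z≤n (s≤s z≤n))) λ ()
      ... | inj₂ (inj₂ evenNeighbours) =
        contradiction (trans (sym (evenNeighbours (suc s) z≤n ≤-refl z~mid)) (parity-suc s s-even)) λ ()

      middleNeighbourOdd : Adj z (v (suc s)) → parity s ≡ 1ℙ → InducedMeynielObstructionIn G X
      middleNeighbourOdd z~mid s-odd
        with OnP.chordlessInterval z~mid z~vₚ 1+s≤p ≤-refl noChordAfterMiddle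
      ... | inj₁ obstruction = obstruction
      ... | inj₂ (inj₁ allAdjacent) =
        contradiction (trans (sym (oddAfter (n≤1+n _) 3+s≤p (allAdjacent _ (m≤n+m (suc s) 2) 3+s≤p)))
                             (parity-suc s s-odd)) λ ()
      ... | inj₂ (inj₂ sameParity) =
        contradiction (trans (sym (Odd⇒parity≡1ℙ p-odd))
                             (trans (sameParity _ 1+s≤p ≤-refl z~vₚ) (parity-suc s s-odd))) λ ()

      obstruction : InducedMeynielObstructionIn G X
      obstruction with dec z (v (suc s)) | parity s in s-parity
      ... | no ¬z~mid | _  = middleNonNeighbour ¬z~mid
      ... | yes z~mid | 0ℙ = middleNeighbourEven z~mid s-parity
      ... | yes z~mid | 1ℙ = middleNeighbourOdd z~mid s-parity

    obstruction : InducedMeynielObstructionIn G X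
    obstruction
      with OnW.chordlessInterval z~v₀ z~w_q z≤n ≤-refl (λ i j _ _ → shortcut-chordless G unique chord i j)
    ... | inj₁ obstructionOnW = obstructionOnW
    ... | inj₂ (inj₁ allAdjacent) = contradiction allAdjacent notAllAdjacentOnW
    ... | inj₂ (inj₂ evenOnW) = AlternatingNeighbours.obstruction evenOnW

  obstruction : InducedMeynielObstructionIn G X
  obstruction with anyUpTo? shortChordAt? (suc q)
  ... | yes (s , _ , chord) = ShortChordCase.obstruction s chord
  ... | no noShortChord = chordlessCase (noShortChord⇒chordless noShortChord)

lemma2 : {n : ℕ} (G : Graph n) (v : ℕ → Fin n) (p : ℕ) (z : Fin n) →
    NearObstruction G v p z →
    Σ ℕ λ k → Σ (ℕ → Fin n) λ c →
      InducedMeynielObstruction G c k ×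
      (∀ i → i < k → OnPath G v p (c i) ⊎ c i ≡ z)
lemma2 G v zero z (() , _)
lemma2 G v (suc q) z (3≤p , p-odd , path , unique , shortChords , z∉P , z~v₀ , z~vₚ , type) =
  NearObstructionProof.obstruction {G = G} 3≤p p-odd path unique shortChords z∉P z~v₀ z~vₚ type
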